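{- Let $k \ge 3$, let $0 \le v < \lvert I_{k-2}\rvert$, and let $0 \le u \le 2^{k-1}-b_k$ be integers. Then $$\ell c(B_{a_k+v})=\ell c(B_{a_{k-2}+v}),$$ $$\ell c(B_{b_k+u})=\ell c(B_{a_{k-1}+u}),$$ $$\ell c(B_{2^k-(b_k+u)})=\ell c(B_{a_{k-1}+u}),$$ $$\ell c(B_{c_k+v})=\ell c(B_{2^{k-2}-(a_{k-2}+v)})+\ell c(B_{a_{k-2}+v}).$$
   Context: The Stern polynomials $B_n(t)\in\mathbb{Z}[t]$ are defined by $B_0=0$, $B_1=1$, $B_{2n}=tB_n$, $B_{2n+1}=B_n+B_{n+1}$; $\ell c$ denotes the leading coefficient in $t$. A BSD representation of an integer $n$ is a digit string $(b_{m-1}\cdots b_0)$ with $b_j\in\{1,0,-1\}$ and $n=\sum b_j2^j$. A non-adjacent form (NAF) is a BSD representation in which no two adjacent digits are both nonzero; it is reduced if its leading digit is nonzero. Every positive integer has exactly one reduced NAF; its length is the NAF-bitlength of $n$. $I_k$ denotes the set of positive integers of NAF-bitlength $k$; it is a set of consecutive integers (e.g. $I_1=\{1\}$, $I_2=\{2\}$, $I_3=\{3,4,5\}$), and for $k\ge3$, $\lvert I_k\rvert=2\lvert I_{k-2}\rvert+\lvert I_{k-1}\rvert$. Write $a_k=\min I_k$ for $k\ge1$ and $a_0=0$ (equivalently $a_1=1,a_2=2$, $a_k=2^{k-2}+a_{k-2}$). For $k\ge3$, $I_k$ is partitioned into consecutive subintervals $\mathcal{A}_k$ (first $\lvert I_{k-2}\rvert$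 elements), $\mathcal{B}_k$ (next $\lvert I_{k-1}\rvert$ elements), $\mathcal{C}_k$ (last $\lvert I_{k-2}\rvert$ elements), with minima $a_k$, $b_k=a_k+\lvert I_{k-2}\rvert$, $c_k=b_k+\lvert I_{k-1}\rvert=2^{k-1}+a_{k-2}$. -}

module Defs where

open import Data.Nat using (ℕ; zero; suc; _^_; _∸_; _%_; ⌊_/2⌋)
import Data.Nat as N
open import Data.Integer using (ℤ; 0ℤ; 1ℤ; _≟_) renaming (_+_ to _+ℤ_)
open import Data.List using (List; []; _∷_)
open import Relation.Nullary using (yes; no)

-- Polynomials in ℤ[t] as coefficient lists, lowest degree first
-- (trailing zeros allowed; they do not affect the leading coefficient).
Poly : Set
Poly = List ℤ

_⊕_ : Poly → Poly → Poly
[] ⊕ q = q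
(x ∷ p) ⊕ [] = x ∷ p
(x ∷ p) ⊕ (y ∷ q) = (x +ℤ y) ∷ (p ⊕ q)

tmul : Poly → Poly
tmul p = 0ℤ ∷ p

-- leading coefficient: the last nonzero coefficient (0 for the zero polynomial)
lc : Poly → ℤ
lc [] = 0ℤ
lc (x ∷ p) with lc p ≟ 0ℤ
... | yes _ = x
... | no _ = lc p

-- Stern polynomials, computed with fuel (fuel n+1 suffices for index n)
sternF : ℕ → ℕ → Poly
sternF zero n = []
sternF (suc f) zero = []
sternF (suc f) (suc zero) = 1ℤ ∷ []
sternF (suc f) n@(suc (suc _)) with n % 2
... | zero = tmul (sternF f ⌊ n /2⌋)
... | suc _ = sternF f ⌊ n /2⌋ ⊕ sternF f (suc ⌊ n /2⌋)

-- B_0 = 0, B_1 = 1, B_{2n} = t B_n, B_{2n+1} = B_n + B_{n+1}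
B : ℕ → Poly
B n = sternF (suc n) n

-- a_k = min I_k (a_0 = 0, a_1 = 1, a_2 = 2, a_k = 2^(k-2) + a_(k-2))
a : ℕ → ℕ
a zero = 0
a (suc zero) = 1
a (suc (suc zero)) = 2
a (suc (suc (suc k))) = 2 ^ (suc k) N.+ a (suc k)

-- |I_k| : the I_k are consecutive blocks of positive integers, I_k = [a_k, a_(k+1))
sizeI : ℕ → ℕ
sizeI k = a (suc k) ∸ a k

b : ℕ → ℕ
b k = a k N.+ sizeI (k ∸ 2)

c : ℕ → ℕ
c k = b k N.+ sizeI (k ∸ 1)

-- Stern polynomials have nonnegative coefficients, so nothing cancels in
-- B (2n+1) = B n + B (n+1): the leading term of a sum is that of the summand of larger
-- degree, with the coefficients added on a tie.  Writing X ~ Y for "same leading term",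
-- one gets B (2^m + n) ~ t B n + B p whenever n + p = 2^m, and induction on j shows that
-- for r + s = 2^j the degree of B r is smaller than, equal to, or larger than that of B s
-- according as r lies before, in, or after I_j.  With M = 2^(k-2):
--   on A_k and B_k, B (M + m) ~ t B m since deg B m ≥ deg B (M - m);
--   2^k - (b_k + u) = 2M + q with q = M - m, m = a_(k-1) + u, and B (2M + q) ~ t B q + t B m
--   where deg B q < deg B m;
--   c_k + v = 2M + n with n = a_(k-2) + v, p = M - n, and B (2M + n) ~ t B n + t B p + B n
--   where deg B n = deg B p, so the two leading coefficients add.

{-# OPTIONS --safe #-}
module Submission where

open import Defs
open import Data.Nat using (ℕ; zero; suc; _≤_; _<_; _+_; _*_; _∸_; _^_; _%_; ⌊_/2⌋; z≤n; s≤s; _⊔_; _≤?_; _<?_)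
open import Data.Nat.Properties hiding (_≟_)
open import Data.Nat.Induction using (<-rec)
open import Data.Nat.Tactic.RingSolver using (solve-∀)
open import Data.Integer using (ℤ; +_; 0ℤ; _≟_; +≤+) renaming (_+_ to _+ℤ_; _≤_ to _≤ℤ_)
import Data.Integer.Properties as ℤ
open import Data.List using ([]; _∷_)
open import Data.List.Relation.Unary.All using (All; []; _∷_)
open import Data.Product using (_×_; _,_; proj₁)
open import Data.Empty using (⊥-elim)
open import Function using (_∘_)
open import Relation.Nullary using (Dec; yes; no)
open import Relation.Binary.PropositionalEquality

sternF-fuel : ∀ {f g} n → n < f → n < g → sternF f n ≡ sternF g n
sternF-fuel {suc f} {suc g} zero _ _ = refl
sternF-fuel {suc f} {suc g} (suc zero) _ _ = refl
sternF-fuel {suc (suc f)} {suc (suc g)} (suc (suc zero)) _ _ = refl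
sternF-fuel {suc f} {suc g} n@(suc (suc (suc m))) (s≤s n≤f) (s≤s n≤g) with n % 2
... | zero  = cong tmul (sternF-fuel _ (<-≤-trans lo n≤f) (<-≤-trans lo n≤g))
  where
  lo : ⌊ n /2⌋ < n
  lo = ⌊n/2⌋<n (suc (suc m))
... | suc _ = cong₂ _⊕_ (sternF-fuel _ (<-≤-trans lo n≤f) (<-≤-trans lo n≤g))
                        (sternF-fuel _ (<-≤-trans hi n≤f) (<-≤-trans hi n≤g))
  where
  lo : ⌊ n /2⌋ < n
  lo = ⌊n/2⌋<n (suc (suc m))
  hi : suc ⌊ n /2⌋ < n
  hi = s≤s (s≤s (⌊n/2⌋<n m))

n+n%2≡0 : ∀ n → (n + n) % 2 ≡ 0
n+n%2≡0 zero = refl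
n+n%2≡0 (suc n) rewrite +-suc n n = n+n%2≡0 n

1+n+n%2≡1 : ∀ n → suc (n + n) % 2 ≡ 1
1+n+n%2≡1 zero = refl
1+n+n%2≡1 (suc n) rewrite +-suc n n = 1+n+n%2≡1 n

⌊1+n+n/2⌋≡n : ∀ n → ⌊ suc (n + n) /2⌋ ≡ n
⌊1+n+n/2⌋≡n zero = refl
⌊1+n+n/2⌋≡n (suc n) rewrite +-suc n n = cong suc (⌊1+n+n/2⌋≡n n)

sternF-even : ∀ f m → suc (suc m) % 2 ≡ 0 →
              sternF (suc f) (suc (suc m)) ≡ tmul (sternF f (suc ⌊ m /2⌋))
sternF-even f m even rewrite even = refl

sternF-odd : ∀ f m → suc (suc m) % 2 ≡ 1 →
             sternF (suc f) (suc (suc m)) ≡ sternF f (suc ⌊ m /2⌋) ⊕ sternF f (suc (suc ⌊ m /2⌋))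
sternF-odd f m odd rewrite odd = refl

B-double : ∀ n → B (suc n + suc n) ≡ tmul (B (suc n))
B-double n rewrite +-suc n n
  | sternF-even (suc (suc (n + n))) (n + n) (n+n%2≡0 n) | sym (n≡⌊n+n/2⌋ n) =
  cong tmul (sternF-fuel (suc n) (s≤s (s≤s (m≤m+n n n))) ≤-refl)

B-double+1 : ∀ n → B (suc (n + n)) ≡ B n ⊕ B (suc n)
B-double+1 zero = refl
B-double+1 (suc n) rewrite +-suc n n
  | sternF-odd (suc (suc (suc (n + n)))) (suc (n + n)) (1+n+n%2≡1 n) | ⌊1+n+n/2⌋≡n n =
  cong₂ _⊕_ (sternF-fuel (suc n) (s≤s (s≤s (m≤n⇒m≤1+n (m≤m+n n n)))) ≤-refl)
            (sternF-fuel (suc (suc n)) (s≤s (s≤s (s≤s (m≤m+n n n)))) ≤-refl)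

NonNeg : Poly → Set
NonNeg = All (0ℤ ≤ℤ_)

⊕-nonneg : ∀ {p q} → NonNeg p → NonNeg q → NonNeg (p ⊕ q)
⊕-nonneg {[]}    _ nq = nq
⊕-nonneg {_ ∷ _} {[]} np _ = np
⊕-nonneg (+≤+ _ ∷ np) (+≤+ _ ∷ nq) = +≤+ z≤n ∷ ⊕-nonneg np nq

sternF-nonneg : ∀ f n → NonNeg (sternF f n)
sternF-nonneg zero n = []
sternF-nonneg (suc f) zero = []
sternF-nonneg (suc f) (suc zero) = +≤+ z≤n ∷ []
sternF-nonneg (suc f) n@(suc (suc _)) with n % 2
... | zero  = +≤+ z≤n ∷ sternF-nonneg f _
... | suc _ = ⊕-nonneg (sternF-nonneg f _) (sternF-nonneg f _)

B-nonneg : ∀ n → NonNeg (B n)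
B-nonneg n = sternF-nonneg (suc n) n

-- (d , l) stands for the monomial l t^d.
Term : Set
Term = ℕ × ℤ

raise : Term → Term
raise (d , l) = suc d , l

_⊞ᵗ_ : Term → Term → Term
(zero  , l₁) ⊞ᵗ (zero  , l₂) = zero , l₁ +ℤ l₂
(zero  , _ ) ⊞ᵗ (suc d₂ , l₂) = suc d₂ , l₂
(suc d₁ , l₁) ⊞ᵗ (zero  , _ ) = suc d₁ , l₁
(suc d₁ , l₁) ⊞ᵗ (suc d₂ , l₂) = raise ((d₁ , l₁) ⊞ᵗ (d₂ , l₂))

data Lead : Set where
  none : Lead
  term : Term → Lead

shift : Lead → Lead
shift none     = none
shift (term t) = term (raise t)

infixl 6 _⊞_
_⊞_ : Lead → Lead → Lead
none   ⊞ y      = y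
term s ⊞ none   = term s
term s ⊞ term t = term (s ⊞ᵗ t)

coeff : Lead → ℤ
coeff none           = 0ℤ
coeff (term (_ , l)) = l

deg⁺ : Lead → ℕ
deg⁺ none           = 0
deg⁺ (term (d , _)) = suc d

⊞-identityʳ : ∀ x → x ⊞ none ≡ x
⊞-identityʳ none     = refl
⊞-identityʳ (term _) = refl

⊞ᵗ-comm : ∀ s t → s ⊞ᵗ t ≡ t ⊞ᵗ s
⊞ᵗ-comm (zero  , l₁) (zero  , l₂) = cong (zero ,_) (ℤ.+-comm l₁ l₂)
⊞ᵗ-comm (zero  , _ ) (suc _ , _ ) = refl
⊞ᵗ-comm (suc _ , _ ) (zero  , _ ) = refl
⊞ᵗ-comm (suc d₁ , l₁) (suc d₂ , l₂) = cong raise (⊞ᵗ-comm (d₁ , l₁) (d₂ , l₂))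

⊞-comm : ∀ x y → x ⊞ y ≡ y ⊞ x
⊞-comm none     none     = refl
⊞-comm none     (term _) = refl
⊞-comm (term _) none     = refl
⊞-comm (term s) (term t) = cong term (⊞ᵗ-comm s t)

⊞ᵗ-assoc : ∀ s t u → (s ⊞ᵗ t) ⊞ᵗ u ≡ s ⊞ᵗ (t ⊞ᵗ u)
⊞ᵗ-assoc (zero , l₁) (zero , l₂) (zero , l₃) = cong (zero ,_) (ℤ.+-assoc l₁ l₂ l₃)
⊞ᵗ-assoc (zero , _) (zero , _) (suc _ , _) = refl
⊞ᵗ-assoc (zero , _) (suc _ , _) (zero , _) = refl
⊞ᵗ-assoc (zero , _) (suc _ , _) (suc _ , _) = refl
⊞ᵗ-assoc (suc _ , _) (zero , _) (zero , _) = refl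
⊞ᵗ-assoc (suc _ , _) (zero , _) (suc _ , _) = refl
⊞ᵗ-assoc (suc _ , _) (suc _ , _) (zero , _) = refl
⊞ᵗ-assoc (suc d₁ , l₁) (suc d₂ , l₂) (suc d₃ , l₃) = cong raise (⊞ᵗ-assoc (d₁ , l₁) (d₂ , l₂) (d₃ , l₃))

⊞-assoc : ∀ x y z → (x ⊞ y) ⊞ z ≡ x ⊞ (y ⊞ z)
⊞-assoc none     _        _        = refl
⊞-assoc (term _) none     _        = refl
⊞-assoc (term _) (term _) none     = refl
⊞-assoc (term s) (term t) (term u) = cong term (⊞ᵗ-assoc s t u)

⊞-interchange : ∀ w x y z → (w ⊞ x) ⊞ (y ⊞ z) ≡ (w ⊞ y) ⊞ (x ⊞ z)
⊞-interchange w x y z = begin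
  (w ⊞ x) ⊞ (y ⊞ z)  ≡⟨ ⊞-assoc w x (y ⊞ z) ⟩
  w ⊞ (x ⊞ (y ⊞ z))  ≡⟨ cong (w ⊞_) (sym (⊞-assoc x y z)) ⟩
  w ⊞ ((x ⊞ y) ⊞ z)  ≡⟨ cong (λ v → w ⊞ (v ⊞ z)) (⊞-comm x y) ⟩
  w ⊞ ((y ⊞ x) ⊞ z)  ≡⟨ cong (w ⊞_) (⊞-assoc y x z) ⟩
  w ⊞ (y ⊞ (x ⊞ z))  ≡⟨ sym (⊞-assoc w y (x ⊞ z)) ⟩
  (w ⊞ y) ⊞ (x ⊞ z)  ∎
  where open ≡-Reasoning

shift-⊞ : ∀ x y → shift (x ⊞ y) ≡ shift x ⊞ shift y
shift-⊞ none     _        = refl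
shift-⊞ (term _) none     = refl
shift-⊞ (term _) (term _) = refl

coeff-shift : ∀ x → coeff (shift x) ≡ coeff x
coeff-shift none     = refl
coeff-shift (term _) = refl

deg⁺-shift : ∀ x → 1 ≤ deg⁺ x → deg⁺ (shift x) ≡ suc (deg⁺ x)
deg⁺-shift (term _) _ = refl

deg⁺-shift-≤ : ∀ x → deg⁺ (shift x) ≤ suc (deg⁺ x)
deg⁺-shift-≤ none     = z≤n
deg⁺-shift-≤ (term _) = ≤-refl

deg⁺-shift-≥ : ∀ x → deg⁺ x ≤ deg⁺ (shift x)
deg⁺-shift-≥ none     = z≤n
deg⁺-shift-≥ (term _) = n≤1+n _

⊞ᵗ-dominant : ∀ s t → proj₁ t < proj₁ s → s ⊞ᵗ t ≡ s
⊞ᵗ-dominant (suc _ , _) (zero , _) _ = refl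
⊞ᵗ-dominant (suc d₁ , l₁) (suc d₂ , l₂) (s≤s d₂<d₁) = cong raise (⊞ᵗ-dominant (d₁ , l₁) (d₂ , l₂) d₂<d₁)

⊞-dominant : ∀ x y → deg⁺ y < deg⁺ x → x ⊞ y ≡ x
⊞-dominant (term _) none     _          = refl
⊞-dominant (term s) (term t) (s≤s t<s) = cong term (⊞ᵗ-dominant s t t<s)

shift-⊞-dominant : ∀ x y → 1 ≤ deg⁺ x → deg⁺ y ≤ deg⁺ x → shift x ⊞ y ≡ shift x
shift-⊞-dominant x y 1≤x y≤x =
  ⊞-dominant (shift x) y (subst (deg⁺ y <_) (sym (deg⁺-shift x 1≤x)) (s≤s y≤x))

deg-⊞ᵗ : ∀ s t → proj₁ (s ⊞ᵗ t) ≡ proj₁ s ⊔ proj₁ t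
deg-⊞ᵗ (zero , _) (zero , _) = refl
deg-⊞ᵗ (zero , _) (suc _ , _) = refl
deg-⊞ᵗ (suc _ , _) (zero , _) = refl
deg-⊞ᵗ (suc d₁ , l₁) (suc d₂ , l₂) = cong suc (deg-⊞ᵗ (d₁ , l₁) (d₂ , l₂))

deg⁺-⊞ : ∀ x y → deg⁺ (x ⊞ y) ≡ deg⁺ x ⊔ deg⁺ y
deg⁺-⊞ none     _        = refl
deg⁺-⊞ (term _) none     = refl
deg⁺-⊞ (term s) (term t) = cong suc (deg-⊞ᵗ s t)

deg⁺-⊞-≥ʳ : ∀ x y → deg⁺ y ≤ deg⁺ (x ⊞ y)
deg⁺-⊞-≥ʳ x y = subst (deg⁺ y ≤_) (sym (deg⁺-⊞ x y)) (m≤n⊔m (deg⁺ x) (deg⁺ y))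

⊞ᵗ-sameDeg : ∀ d l₁ l₂ → (d , l₁) ⊞ᵗ (d , l₂) ≡ (d , l₁ +ℤ l₂)
⊞ᵗ-sameDeg zero    _  _  = refl
⊞ᵗ-sameDeg (suc d) l₁ l₂ = cong raise (⊞ᵗ-sameDeg d l₁ l₂)

coeff-⊞-sameDeg : ∀ x y → deg⁺ x ≡ deg⁺ y → coeff (x ⊞ y) ≡ coeff x +ℤ coeff y
coeff-⊞-sameDeg none     none             _    = refl
coeff-⊞-sameDeg (term (d , l₁)) (term (.d , l₂)) refl = cong (coeff ∘ term) (⊞ᵗ-sameDeg d l₁ l₂)

leadCons : ∀ x → Dec (x ≡ 0ℤ) → Lead → Lead
leadCons _ _       (term t) = term (raise t)
leadCons _ (yes _) none     = none
leadCons x (no _)  none     = term (0 , x)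

lead : Poly → Lead
lead []      = none
lead (x ∷ p) = leadCons x (x ≟ 0ℤ) (lead p)

coeff-leadCons-none : ∀ x x≟0 → coeff (leadCons x x≟0 none) ≡ x
coeff-leadCons-none _ (yes x≡0) = sym x≡0
coeff-leadCons-none _ (no _)    = refl

coeff≡0⇒lead≡none : ∀ p → coeff (lead p) ≡ 0ℤ → lead p ≡ none
coeff≡0⇒lead≡none []      _ = refl
coeff≡0⇒lead≡none (x ∷ p) c≡0 with x ≟ 0ℤ | lead p | coeff≡0⇒lead≡none p
... | yes _   | none   | _  = refl
... | no x≢0 | none   | _  = ⊥-elim (x≢0 c≡0)
... | _       | term _ | ih with () ← ih c≡0

lc≡coeff∘lead : ∀ p → lc p ≡ coeff (lead p)
lc≡coeff∘lead []      = refl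
lc≡coeff∘lead (x ∷ p) with lc p ≟ 0ℤ | lc≡coeff∘lead p
... | yes lc≡0 | ih rewrite coeff≡0⇒lead≡none p (trans (sym ih) lc≡0) = sym (coeff-leadCons-none x (x ≟ 0ℤ))
... | no lc≢0  | ih with lead p
...   | none   = ⊥-elim (lc≢0 ih)
...   | term _ = ih

leadCons-+ : ∀ m n x y →
  leadCons (+ m +ℤ + n) (+ m +ℤ + n ≟ 0ℤ) (x ⊞ y) ≡ leadCons (+ m) (+ m ≟ 0ℤ) x ⊞ leadCons (+ n) (+ n ≟ 0ℤ) y
leadCons-+ zero    zero    none     none     = refl
leadCons-+ zero    (suc _) none     none     = refl
leadCons-+ (suc m) zero    none     none     rewrite +-identityʳ m = refl
leadCons-+ (suc _) (suc _) none     none     = refl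
leadCons-+ zero    _       none     (term _) = refl
leadCons-+ (suc _) _       none     (term _) = refl
leadCons-+ _       zero    (term _) none     = refl
leadCons-+ _       (suc _) (term _) none     = refl
leadCons-+ _       _       (term _) (term _) = refl

lead-⊕ : ∀ {p q} → NonNeg p → NonNeg q → lead (p ⊕ q) ≡ lead p ⊞ lead q
lead-⊕ {[]}    _ _ = refl
lead-⊕ {_ ∷ _} {[]} _ _ = sym (⊞-identityʳ _)
lead-⊕ {+ m ∷ p} {+ n ∷ q} (+≤+ _ ∷ np) (+≤+ _ ∷ nq) rewrite lead-⊕ np nq = leadCons-+ m n (lead p) (lead q)

lead-tmul : ∀ p → lead (tmul p) ≡ shift (lead p)
lead-tmul p with lead p
... | none   = refl
... | term _ = refl

leadB : ℕ → Lead
leadB n = lead (B n)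

degB : ℕ → ℕ
degB n = deg⁺ (leadB n)

lc-B : ∀ n → lc (B n) ≡ coeff (leadB n)
lc-B n = lc≡coeff∘lead (B n)

2*n≡n+n : ∀ n → 2 * n ≡ n + n
2*n≡n+n n = cong (_+_ n) (+-identityʳ n)

leadB-double : ∀ n → leadB (2 * n) ≡ shift (leadB n)
leadB-double zero    = refl
leadB-double (suc n) = begin
  leadB (2 * suc n)         ≡⟨ cong leadB (2*n≡n+n (suc n)) ⟩
  lead (B (suc n + suc n))  ≡⟨ cong lead (B-double n) ⟩
  lead (tmul (B (suc n)))   ≡⟨ lead-tmul (B (suc n)) ⟩
  shift (leadB (suc n))     ∎
  where open ≡-Reasoning

leadB-double+1 : ∀ n → leadB (suc (2 * n)) ≡ leadB n ⊞ leadB (suc n)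
leadB-double+1 n = begin
  leadB (suc (2 * n))         ≡⟨ cong (leadB ∘ suc) (2*n≡n+n n) ⟩
  lead (B (suc (n + n)))      ≡⟨ cong lead (B-double+1 n) ⟩
  lead (B n ⊕ B (suc n))      ≡⟨ lead-⊕ (B-nonneg n) (B-nonneg (suc n)) ⟩
  leadB n ⊞ leadB (suc n)     ∎
  where open ≡-Reasoning

data Parity : ℕ → Set where
  even : ∀ r → Parity (2 * r)
  odd  : ∀ r → Parity (suc (2 * r))

parity : ∀ n → Parity n
parity zero = even 0
parity (suc n) with parity n
... | even r = odd r
... | odd r  = subst Parity (*-suc 2 r) (even (suc r))

2x+[1+2y]≡1+2[x+y] : ∀ x y → 2 * x + suc (2 * y) ≡ suc (2 * (x + y))
2x+[1+2y]≡1+2[x+y] = solve-∀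

[1+2x]+2y≡1+2[x+y] : ∀ x y → suc (2 * x) + 2 * y ≡ suc (2 * (x + y))
[1+2x]+2y≡1+2[x+y] = solve-∀

[1+2x]+[1+2y]≡2[1+x+y] : ∀ x y → suc (2 * x) + suc (2 * y) ≡ 2 * (suc x + y)
[1+2x]+[1+2y]≡2[1+x+y] = solve-∀

leadB-2^m+ : ∀ m n p → n + p ≡ 2 ^ m → leadB (2 ^ m + n) ≡ shift (leadB n) ⊞ leadB p
leadB-2^m+ zero 0             .1 refl = refl
leadB-2^m+ zero 1             .0 refl = refl
leadB-2^m+ zero (suc (suc n)) p  ()
leadB-2^m+ (suc m) n p e with parity n | parity p
... | even r | even q = begin
  leadB (2 * M + 2 * r)                       ≡⟨ cong leadB (sym (*-distribˡ-+ 2 M r)) ⟩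
  leadB (2 * (M + r))                         ≡⟨ leadB-double (M + r) ⟩
  shift (leadB (M + r))                       ≡⟨ cong shift (leadB-2^m+ m r q r+q≡M) ⟩
  shift (shift (leadB r) ⊞ leadB q)           ≡⟨ shift-⊞ (shift (leadB r)) (leadB q) ⟩
  shift (shift (leadB r)) ⊞ shift (leadB q)   ≡⟨ sym (cong₂ _⊞_ (cong shift (leadB-double r)) (leadB-double q)) ⟩
  shift (leadB (2 * r)) ⊞ leadB (2 * q)       ∎
  where
  open ≡-Reasoning
  M : ℕ
  M = 2 ^ m
  r+q≡M : r + q ≡ M
  r+q≡M = *-cancelˡ-≡ (r + q) M 2 (trans (*-distribˡ-+ 2 r q) e)
... | odd r | odd q = begin
  leadB (2 * M + suc (2 * r))                 ≡⟨ cong leadB (2x+[1+2y]≡1+2[x+y] M r) ⟩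
  leadB (suc (2 * (M + r)))                   ≡⟨ leadB-double+1 (M + r) ⟩
  leadB (M + r) ⊞ leadB (suc (M + r))         ≡⟨ cong₂ _⊞_ (leadB-2^m+ m r (suc q) r+1+q≡M)
                                                            (trans (cong leadB (sym (+-suc M r))) (leadB-2^m+ m (suc r) q 1+r+q≡M)) ⟩
  (shift (leadB r) ⊞ leadB (suc q)) ⊞ (shift (leadB (suc r)) ⊞ leadB q)
                                              ≡⟨ ⊞-interchange (shift (leadB r)) (leadB (suc q)) (shift (leadB (suc r))) (leadB q) ⟩
  (shift (leadB r) ⊞ shift (leadB (suc r))) ⊞ (leadB (suc q) ⊞ leadB q)
                                              ≡⟨ cong₂ _⊞_ (sym (shift-⊞ (leadB r) (leadB (suc r)))) (⊞-comm (leadB (suc q)) (leadB q)) ⟩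
  shift (leadB r ⊞ leadB (suc r)) ⊞ (leadB q ⊞ leadB (suc q))
                                              ≡⟨ sym (cong₂ _⊞_ (cong shift (leadB-double+1 r)) (leadB-double+1 q)) ⟩
  shift (leadB (suc (2 * r))) ⊞ leadB (suc (2 * q)) ∎
  where
  open ≡-Reasoning
  M : ℕ
  M = 2 ^ m
  1+r+q≡M : suc r + q ≡ M
  1+r+q≡M = *-cancelˡ-≡ (suc r + q) M 2 (trans (sym ([1+2x]+[1+2y]≡2[1+x+y] r q)) e)
  r+1+q≡M : r + suc q ≡ M
  r+1+q≡M = trans (+-suc r q) 1+r+q≡M
... | even r | odd q = ⊥-elim (even≢odd (2 ^ m) (r + q) (trans (sym e) (2x+[1+2y]≡1+2[x+y] r q)))
... | odd r | even q = ⊥-elim (even≢odd (2 ^ m) (r + q) (trans (sym e) ([1+2x]+2y≡1+2[x+y] r q)))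

1≤degB : ∀ n → 1 ≤ n → 1 ≤ degB n
1≤degB = <-rec (λ n → 1 ≤ n → 1 ≤ degB n) step
  where
  step : ∀ n → (∀ {m} → m < n → 1 ≤ m → 1 ≤ degB m) → 1 ≤ n → 1 ≤ degB n
  step n rec 1≤n with parity n
  ... | even zero    = ⊥-elim (1+n≰n 1≤n)
  ... | even (suc r) = subst (λ x → 1 ≤ deg⁺ x) (sym (leadB-double (suc r)))
    (≤-trans (rec (m<m+n (suc r) (s≤s z≤n)) (s≤s z≤n)) (deg⁺-shift-≥ (leadB (suc r))))
  ... | odd zero     = s≤s z≤n
  ... | odd (suc r)  = subst (λ x → 1 ≤ deg⁺ x) (sym (leadB-double+1 (suc r)))
    (≤-trans (rec (s≤s (m<m+n (suc r) (s≤s z≤n))) (s≤s z≤n)) (deg⁺-⊞-≥ʳ (leadB (suc r)) (leadB (suc (suc r)))))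

degB[2^m+x] : ∀ m x y → x + y ≡ 2 ^ m → degB (2 ^ m + x) ≡ deg⁺ (shift (leadB x)) ⊔ degB y
degB[2^m+x] m x y e = trans (cong deg⁺ (leadB-2^m+ m x y e)) (deg⁺-⊞ (shift (leadB x)) (leadB y))

degB[2^m+x]>degB[x] : ∀ m x y → x + y ≡ 2 ^ m → 1 ≤ x → degB x < degB (2 ^ m + x)
degB[2^m+x]>degB[x] m x y e 1≤x = begin-strict
  degB x                          <⟨ n<1+n (degB x) ⟩
  suc (degB x)                    ≡⟨ sym (deg⁺-shift (leadB x) (1≤degB x 1≤x)) ⟩
  deg⁺ (shift (leadB x))          ≤⟨ m≤m⊔n _ (degB y) ⟩
  deg⁺ (shift (leadB x)) ⊔ degB y ≡⟨ sym (degB[2^m+x] m x y e) ⟩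
  degB (2 ^ m + x)                ∎
  where open ≤-Reasoning

degB[2^m+x]≡degB[y] : ∀ m x y → x + y ≡ 2 ^ m → degB x < degB y → degB (2 ^ m + x) ≡ degB y
degB[2^m+x]≡degB[y] m x y e x<y =
  trans (degB[2^m+x] m x y e) (m≤n⇒m⊔n≡n (≤-trans (deg⁺-shift-≤ (leadB x)) x<y))

a-pos : ∀ i → 1 ≤ a (suc i)
a-pos zero          = s≤s z≤n
a-pos (suc zero)    = s≤s z≤n
a-pos (suc (suc i)) = ≤-trans (a-pos i) (m≤n+m _ _)

a≤2^ : ∀ i → a (suc i) ≤ 2 ^ i
a≤2^ zero          = ≤-refl
a≤2^ (suc zero)    = ≤-refl
a≤2^ (suc (suc i)) = subst (2 ^ suc i + a (suc i) ≤_) (sym (2*n≡n+n (2 ^ suc i)))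
  (+-monoʳ-≤ (2 ^ suc i) (≤-trans (a≤2^ i) (m≤m+n (2 ^ i) _)))

a-mono : ∀ i → a i ≤ a (suc i)
a-mono zero          = z≤n
a-mono (suc zero)    = s≤s z≤n
a-mono (suc (suc i)) = ≤-trans (a≤2^ (suc i)) (m≤m+n _ _)

complement-positive : ∀ {r t M} → r + t ≡ M → r < M → 1 ≤ t
complement-positive {r} {zero}  refl r<r+0 = ⊥-elim (<-irrefl (sym (+-identityʳ r)) r<r+0)
complement-positive {_} {suc _} _    _     = s≤s z≤n

data Halves (M : ℕ) : ℕ → ℕ → Set where
  lower : ∀ {r t} → r + t ≡ M → Halves M r (M + t)
  upper : ∀ {n s} → n + s ≡ M → Halves M (M + n) s

halves : ∀ M r s → r + s ≡ 2 * M → Halves M r s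
halves M r s e with r ≤? M
... | yes r≤M = subst (Halves M r) M+[M∸r]≡s (lower (m+[n∸m]≡n r≤M))
  where
  open ≡-Reasoning
  M+[M∸r]≡s : M + (M ∸ r) ≡ s
  M+[M∸r]≡s = begin
    M + (M ∸ r)  ≡⟨ sym (+-∸-assoc M r≤M) ⟩
    M + M ∸ r    ≡⟨ cong (_∸ r) (trans (sym (2*n≡n+n M)) (sym e)) ⟩
    r + s ∸ r    ≡⟨ m+n∸m≡n r s ⟩
    s            ∎
... | no r≰M  = subst (λ x → Halves M x s) (m+[n∸m]≡n M≤r) (upper [r∸M]+s≡M)
  where
  M≤r : M ≤ r
  M≤r = ≰⇒≥ r≰M
  open ≡-Reasoning
  [r∸M]+s≡M : (r ∸ M) + s ≡ M
  [r∸M]+s≡M = begin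
    r ∸ M + s    ≡⟨ sym (+-∸-comm s M≤r) ⟩
    r + s ∸ M    ≡⟨ cong (_∸ M) (trans e (2*n≡n+n M)) ⟩
    M + M ∸ M    ≡⟨ m+n∸m≡n M M ⟩
    M            ∎

record ComplementDegrees (j : ℕ) : Set where
  field
    below  : ∀ r s → r + s ≡ 2 ^ j → r < a j → degB r < degB s
    inside : ∀ r s → r + s ≡ 2 ^ j → a j ≤ r → r < a (suc j) → degB r ≡ degB s
    above  : ∀ r s → r + s ≡ 2 ^ j → a (suc j) ≤ r → degB s < degB r

  below-or-inside : ∀ r s → r + s ≡ 2 ^ j → r < a (suc j) → degB r ≤ degB s
  below-or-inside r s e r<a′ with r <? a j
  ... | yes r<a = <⇒≤ (below r s e r<a)
  ... | no r≮a  = ≤-reflexive (inside r s e (≮⇒≥ r≮a) r<a′)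

  inside-or-above : ∀ r s → r + s ≡ 2 ^ j → a j ≤ r → degB s ≤ degB r
  inside-or-above r s e a≤r with r <? a (suc j)
  ... | yes r<a′ = ≤-reflexive (sym (inside r s e a≤r r<a′))
  ... | no r≮a′  = <⇒≤ (above r s e (≮⇒≥ r≮a′))

complementDegrees-base : ComplementDegrees 1
complementDegrees-base = record { below = below ; inside = inside ; above = above }
  where
  below : ∀ r s → r + s ≡ 2 → r < 1 → degB r < degB s
  below zero    .2 refl _       = s≤s z≤n
  below (suc _) _  _    (s≤s ())
  inside : ∀ r s → r + s ≡ 2 → 1 ≤ r → r < 2 → degB r ≡ degB s
  inside 1 .1 refl _ _ = refl
  inside 2 .0 refl _ (s≤s (s≤s ()))
  above : ∀ r s → r + s ≡ 2 → 2 ≤ r → degB s < degB r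
  above 1 _  _    (s≤s ())
  above 2 .0 refl _ = s≤s z≤n

complementDegrees-step : ∀ i → ComplementDegrees (suc i) → ComplementDegrees (suc (suc i))
complementDegrees-step i cd = record { below = below ; inside = inside ; above = above }
  where
  open ComplementDegrees cd using (below-or-inside; inside-or-above) renaming (below to below′; above to above′)
  M : ℕ
  M = 2 ^ suc i

  below : ∀ r s → r + s ≡ 2 * M → r < a (suc (suc i)) → degB r < degB s
  below r s e r<a with halves M r s e
  ... | lower {t = t} r+t≡M = ≤-<-trans (below-or-inside r t r+t≡M r<a)
    (degB[2^m+x]>degB[x] (suc i) t r (trans (+-comm t r) r+t≡M)
      (complement-positive r+t≡M (<-≤-trans r<a (a≤2^ (suc i)))))
  ... | upper _ = ⊥-elim (<⇒≱ r<a (≤-trans (a≤2^ (suc i)) (m≤m+n M _)))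

  inside : ∀ r s → r + s ≡ 2 * M → a (suc (suc i)) ≤ r → r < M + a (suc i) → degB r ≡ degB s
  inside r s e a≤r r<a′ with halves M r s e
  ... | lower {t = t} r+t≡M =
    sym (degB[2^m+x]≡degB[y] (suc i) t r (trans (+-comm t r) r+t≡M) (above′ r t r+t≡M a≤r))
  ... | upper {n = n} n+s≡M =
    degB[2^m+x]≡degB[y] (suc i) n s n+s≡M (below′ n s n+s≡M (+-cancelˡ-< M n _ r<a′))

  above : ∀ r s → r + s ≡ 2 * M → M + a (suc i) ≤ r → degB s < degB r
  above r s e a≤r with halves M r s e
  ... | lower {t = t} r+t≡M = ⊥-elim (<⇒≱ (m<m+n M (a-pos i)) (≤-trans a≤r (subst (r ≤_) r+t≡M (m≤m+n r t))))
  ... | upper {n = n} n+s≡M = ≤-<-trans (inside-or-above n s n+s≡M a≤n)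
    (degB[2^m+x]>degB[x] (suc i) n s n+s≡M (≤-trans (a-pos i) a≤n))
    where
    a≤n : a (suc i) ≤ n
    a≤n = +-cancelˡ-≤ M _ _ a≤r

complementDegrees : ∀ j → ComplementDegrees (suc j)
complementDegrees zero    = complementDegrees-base
complementDegrees (suc j) = complementDegrees-step j (complementDegrees j)

x+[M+y]≡2M : ∀ x y {M} → x + y ≡ M → x + (M + y) ≡ 2 * M
x+[M+y]≡2M x y {M} x+y≡M = begin
  x + (M + y)  ≡⟨ cong (_+_ x) (+-comm M y) ⟩
  x + (y + M)  ≡⟨ sym (+-assoc x y M) ⟩
  x + y + M    ≡⟨ cong (_+ M) x+y≡M ⟩
  M + M        ≡⟨ sym (2*n≡n+n M) ⟩
  2 * M        ∎
  where open ≡-Reasoning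

leadB-shift : ∀ j m → a (suc j) ≤ m → m ≤ 2 ^ suc j → leadB (2 ^ suc j + m) ≡ shift (leadB m)
leadB-shift j m a≤m m≤M = trans (leadB-2^m+ (suc j) m p m+p≡M)
  (shift-⊞-dominant (leadB m) (leadB p) (1≤degB m (≤-trans (a-pos j) a≤m))
    (ComplementDegrees.inside-or-above (complementDegrees j) m p m+p≡M a≤m))
  where
  p : ℕ
  p = 2 ^ suc j ∸ m
  m+p≡M : m + p ≡ 2 ^ suc j
  m+p≡M = m+[n∸m]≡n m≤M

leadB-reflect : ∀ j m → a (suc (suc j)) ≤ m → m ≤ 2 ^ suc j →
                leadB (2 ^ suc (suc j) + (2 ^ suc j ∸ m)) ≡ shift (leadB m)
leadB-reflect j m a≤m m≤M = begin
  leadB (2 * M + q)                      ≡⟨ leadB-2^m+ (suc (suc j)) q (M + m) (x+[M+y]≡2M q m (m∸n+n≡m m≤M)) ⟩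
  shift (leadB q) ⊞ leadB (M + m)        ≡⟨ cong (shift (leadB q) ⊞_) (leadB-shift j m (≤-trans (a-mono (suc j)) a≤m) m≤M) ⟩
  shift (leadB q) ⊞ shift (leadB m)      ≡⟨ sym (shift-⊞ (leadB q) (leadB m)) ⟩
  shift (leadB q ⊞ leadB m)              ≡⟨ cong shift (⊞-comm (leadB q) (leadB m)) ⟩
  shift (leadB m ⊞ leadB q)              ≡⟨ cong shift (⊞-dominant (leadB m) (leadB q) degB[q]<degB[m]) ⟩
  shift (leadB m)                        ∎
  where
  open ≡-Reasoning
  M q : ℕ
  M = 2 ^ suc j
  q = M ∸ m
  degB[q]<degB[m] : degB q < degB m
  degB[q]<degB[m] = ComplementDegrees.above (complementDegrees j) m q (m+[n∸m]≡n m≤M) a≤m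

leadB-split : ∀ j n → a (suc j) ≤ n → n < a (suc (suc j)) →
              leadB (2 ^ suc (suc j) + n) ≡ shift (leadB (2 ^ suc j ∸ n) ⊞ leadB n)
leadB-split j n a≤n n<a = begin
  leadB (2 * M + n)                                    ≡⟨ leadB-2^m+ (suc (suc j)) n (M + p) (x+[M+y]≡2M n p n+p≡M) ⟩
  shift (leadB n) ⊞ leadB (M + p)                      ≡⟨ cong (shift (leadB n) ⊞_) (leadB-2^m+ (suc j) p n (trans (+-comm p n) n+p≡M)) ⟩
  shift (leadB n) ⊞ (shift (leadB p) ⊞ leadB n)        ≡⟨ sym (⊞-assoc (shift (leadB n)) (shift (leadB p)) (leadB n)) ⟩
  shift (leadB n) ⊞ shift (leadB p) ⊞ leadB n          ≡⟨ cong (_⊞ leadB n) (⊞-comm (shift (leadB n)) (shift (leadB p))) ⟩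
  shift (leadB p) ⊞ shift (leadB n) ⊞ leadB n          ≡⟨ cong (_⊞ leadB n) (sym (shift-⊞ (leadB p) (leadB n))) ⟩
  shift (leadB p ⊞ leadB n) ⊞ leadB n                  ≡⟨ shift-⊞-dominant (leadB p ⊞ leadB n) (leadB n) (≤-trans (1≤degB n 1≤n) n≤p+n) n≤p+n ⟩
  shift (leadB p ⊞ leadB n)                            ∎
  where
  open ≡-Reasoning
  M p : ℕ
  M = 2 ^ suc j
  p = M ∸ n
  n+p≡M : n + p ≡ M
  n+p≡M = m+[n∸m]≡n (≤-trans (<⇒≤ n<a) (a≤2^ (suc j)))
  1≤n : 1 ≤ n
  1≤n = ≤-trans (a-pos j) a≤n
  n≤p+n : degB n ≤ deg⁺ (leadB p ⊞ leadB n)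
  n≤p+n = deg⁺-⊞-≥ʳ (leadB p) (leadB n)

lc-B-shifted : ∀ x y → leadB x ≡ shift (leadB y) → lc (B x) ≡ lc (B y)
lc-B-shifted x y eq = begin
  lc (B x)                ≡⟨ lc-B x ⟩
  coeff (leadB x)         ≡⟨ cong coeff eq ⟩
  coeff (shift (leadB y)) ≡⟨ coeff-shift (leadB y) ⟩
  coeff (leadB y)         ≡⟨ sym (lc-B y) ⟩
  lc (B y)                ∎
  where open ≡-Reasoning

lc-B-split : ∀ j n → a (suc j) ≤ n → n < a (suc (suc j)) →
             lc (B (2 ^ suc (suc j) + n)) ≡ lc (B (2 ^ suc j ∸ n)) +ℤ lc (B n)
lc-B-split j n a≤n n<a = begin
  lc (B (2 ^ suc (suc j) + n))            ≡⟨ lc-B (2 ^ suc (suc j) + n) ⟩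
  coeff (leadB (2 ^ suc (suc j) + n))     ≡⟨ cong coeff (leadB-split j n a≤n n<a) ⟩
  coeff (shift (leadB p ⊞ leadB n))       ≡⟨ coeff-shift (leadB p ⊞ leadB n) ⟩
  coeff (leadB p ⊞ leadB n)               ≡⟨ coeff-⊞-sameDeg (leadB p) (leadB n) (sym degB[n]≡degB[p]) ⟩
  coeff (leadB p) +ℤ coeff (leadB n)      ≡⟨ sym (cong₂ _+ℤ_ (lc-B p) (lc-B n)) ⟩
  lc (B p) +ℤ lc (B n)                    ∎
  where
  open ≡-Reasoning
  p : ℕ
  p = 2 ^ suc j ∸ n
  degB[n]≡degB[p] : degB n ≡ degB p
  degB[n]≡degB[p] = ComplementDegrees.inside (complementDegrees j) n p
    (m+[n∸m]≡n (≤-trans (<⇒≤ n<a) (a≤2^ (suc j)))) a≤n n<a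

4M∸[M+m]≡2M+[M∸m] : ∀ M m → m ≤ M → 2 * (2 * M) ∸ (M + m) ≡ 2 * M + (M ∸ m)
4M∸[M+m]≡2M+[M∸m] M m m≤M = begin
  2 * (2 * M) ∸ (M + m)        ≡⟨ cong (_∸ (M + m)) (4M≡M+3M M) ⟩
  M + (2 * M + M) ∸ (M + m)    ≡⟨ [m+n]∸[m+o]≡n∸o M (2 * M + M) m ⟩
  2 * M + M ∸ m                ≡⟨ +-∸-assoc (2 * M) m≤M ⟩
  2 * M + (M ∸ m)              ∎
  where
  open ≡-Reasoning
  4M≡M+3M : ∀ M → 2 * (2 * M) ≡ M + (2 * M + M)
  4M≡M+3M = solve-∀

b≡2^k-2+a[k-1] : ∀ j → b (3 + j) ≡ 2 ^ suc j + a (2 + j)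
b≡2^k-2+a[k-1] j =
  trans (+-assoc (2 ^ suc j) (a (suc j)) _) (cong (_+_ (2 ^ suc j)) (m+[n∸m]≡n (a-mono (suc j))))

c≡2^k-1+a[k-2] : ∀ j → c (3 + j) ≡ 2 ^ suc (suc j) + a (suc j)
c≡2^k-1+a[k-2] j = begin
  b (3 + j) + (a (3 + j) ∸ a (2 + j))     ≡⟨ cong (_+ (a (3 + j) ∸ a (2 + j))) (b≡2^k-2+a[k-1] j) ⟩
  M + a (2 + j) + (a (3 + j) ∸ a (2 + j)) ≡⟨ +-assoc M (a (2 + j)) _ ⟩
  M + (a (2 + j) + (a (3 + j) ∸ a (2 + j))) ≡⟨ cong (_+_ M) (m+[n∸m]≡n (a-mono (2 + j))) ⟩
  M + (M + a (suc j))                     ≡⟨ sym (+-assoc M M (a (suc j))) ⟩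
  M + M + a (suc j)                       ≡⟨ cong (_+ a (suc j)) (sym (2*n≡n+n M)) ⟩
  2 * M + a (suc j)                       ∎
  where
  open ≡-Reasoning
  M : ℕ
  M = 2 ^ suc j

mainTheorem3 : (k v u : ℕ) → 3 ≤ k → v < sizeI (k ∸ 2) → b k + u ≤ 2 ^ (k ∸ 1) →
    (lc (B (a k + v)) ≡ lc (B (a (k ∸ 2) + v)))
    × (lc (B (b k + u)) ≡ lc (B (a (k ∸ 1) + u)))
    × (lc (B (2 ^ k ∸ (b k + u))) ≡ lc (B (a (k ∸ 1) + u)))
    × (lc (B (c k + v)) ≡ lc (B (2 ^ (k ∸ 2) ∸ (a (k ∸ 2) + v))) +ℤ lc (B (a (k ∸ 2) + v)))
mainTheorem3 (suc (suc (suc j))) v u (s≤s (s≤s (s≤s z≤n))) v<|I| b+u≤2M =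
    trans (cong (lc ∘ B) (+-assoc M (a (1 + j)) v))
          (lc-B-shifted (M + n) n (leadB-shift j n (m≤m+n _ v) (≤-trans (<⇒≤ n<a) (a≤2^ (suc j)))))
  , trans (cong (lc ∘ B) b+u≡M+m)
          (lc-B-shifted (M + m) m (leadB-shift j m (≤-trans (a-mono (suc j)) (m≤m+n _ u)) m≤M))
  , trans (cong (λ x → lc (B (2 ^ (3 + j) ∸ x))) b+u≡M+m)
          (trans (cong (lc ∘ B) (4M∸[M+m]≡2M+[M∸m] M m m≤M))
                 (lc-B-shifted (2 * M + (M ∸ m)) m (leadB-reflect j m (m≤m+n _ u) m≤M)))
  , trans (cong (lc ∘ B) (trans (cong (_+ v) (c≡2^k-1+a[k-2] j)) (+-assoc (2 * M) (a (1 + j)) v)))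
          (lc-B-split j n (m≤m+n _ v) n<a)
  where
  M m n : ℕ
  M = 2 ^ suc j
  m = a (2 + j) + u
  n = a (1 + j) + v
  n<a : n < a (2 + j)
  n<a = subst (n <_) (m+[n∸m]≡n (a-mono (suc j))) (+-monoʳ-< (a (1 + j)) v<|I|)
  b+u≡M+m : b (3 + j) + u ≡ M + m
  b+u≡M+m = trans (cong (_+ u) (b≡2^k-2+a[k-1] j)) (+-assoc M (a (2 + j)) u)
  m≤M : m ≤ M
  m≤M = +-cancelˡ-≤ M m M (subst₂ _≤_ b+u≡M+m (2*n≡n+n M) b+u≤2M)
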